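{- Let $n\ge2$, let $p$ be a prime, $q$ a power of $p$, $a_1,\dots,a_{n+1}\in\mathbb{F}_q^*$, and $$f(x_1,\dots,x_{n+1})=a_1x_{n+1}\Big(x_1+\frac1{x_1}\Big)+\cdots+a_nx_{n+1}\Big(x_n+\frac1{x_n}\Big)+a_{n+1}x_{n+1}+\frac1{x_{n+1}}.$$ Then $f$ is non-degenerate if and only if $$\prod_{(c_1,\dots,c_n)\in\{\pm1\}^n}\big(2c_1a_1+2c_2a_2+\cdots+2c_na_n+a_{n+1}\big)\neq0.$$
   Context: The Newton polyhedron $\Delta(f)$ is the convex hull in $\mathbb{R}^{n+1}$ of the origin and the exponent vectors of the monomials of $f$. For a subset $\delta$, $f^\delta$ is the sum of the terms of $f$ with exponents in $\delta$. $f$ is non-degenerate if for every closed face $\delta$ of $\Delta(f)$ (of any dimension) not containing the origin, the partial derivatives $\partial f^\delta/\partial x_1,\dots,\partial f^\delta/\partial x_{n+1}$ have no common zero with $x_1\cdots x_{n+1}\neq0$ over the algebraic closure of $\mathbb{F}_q$. -}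

module Defs where

open import Level using (Level; _⊔_) renaming (suc to lsuc)
open import Algebra.Bundles using (CommutativeRing)
open import Algebra.Morphism.Structures using (module RingMorphisms)
open import Data.Nat as ℕ using (ℕ; zero; suc)
open import Data.Integer as ℤ using (ℤ; +_; -[1+_])
open import Data.Integer.Properties as ℤP using ()
open import Data.Fin as Fin using (Fin; zero; suc; inject₁; fromℕ)
open import Data.Bool using (Bool; true; false; if_then_else_)
open import Data.Vec using (Vec; []; _∷_)
open import Data.List using (List; []; _∷_; map; foldr; concatMap; filter)
open import Data.List.Relation.Unary.All using (All; all?)
open import Data.List.Relation.Unary.Any using (Any)
open import Data.Product using (Σ; ∃; _×_; _,_; proj₁; proj₂)
open import Relation.Nullary using (¬_; Dec; does)
open import Relation.Binary.PropositionalEquality using (_≡_)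

record Field (c ℓ : Level) : Set (lsuc (c ⊔ ℓ)) where
  field
    commutativeRing : CommutativeRing c ℓ
  open CommutativeRing commutativeRing public
  field
    0≉1        : ¬ (0# ≈ 1#)
    _⁻¹        : Carrier → Carrier
    ⁻¹-inverse : ∀ x → ¬ (x ≈ 0#) → (x * (x ⁻¹)) ≈ 1#

HasSize : ∀ {c ℓ} → Field c ℓ → ℕ → Set (c ⊔ ℓ)
HasSize F q = Σ (Fin q → Carrier) λ e →
    (∀ i j → e i ≈ e j → i ≡ j) × (∀ x → ∃ λ i → e i ≈ x)
  where open Field F using (Carrier; _≈_)

-- Univariate polynomials as coefficient lists (constant term first).

module Poly {c ℓ} (K : Field c ℓ) where
  open Field K using (Carrier; 0#; _+_; _*_; _≈_)

  evalPoly : List Carrier → Carrier → Carrier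
  evalPoly []       x = 0#
  evalPoly (a ∷ as) x = a + (x * evalPoly as x)

  -- some coefficient of degree ≥ 1 is nonzero
  NonConstant : List Carrier → Set (c ⊔ ℓ)
  NonConstant []       = Level.Lift (c ⊔ ℓ) Data.Empty.⊥
    where import Data.Empty
  NonConstant (a ∷ as) = Any (λ b → ¬ (b ≈ 0#)) as

  AlgebraicallyClosed : Set (c ⊔ ℓ)
  AlgebraicallyClosed =
    ∀ (P : List Carrier) → NonConstant P → ∃ λ x → evalPoly P x ≈ 0#

record IsAlgebraicClosure {c ℓ c' ℓ'} (F : Field c ℓ) (K : Field c' ℓ')
         (φ : Field.Carrier F → Field.Carrier K) : Set (c ⊔ ℓ ⊔ c' ⊔ ℓ') where
  private
    module F = Field F
    module K = Field K
  open Poly K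
  field
    isRingHom : RingMorphisms.IsRingHomomorphism F.rawRing K.rawRing φ
    closed    : AlgebraicallyClosed
    algebraic : ∀ (y : K.Carrier) → ∃ λ (P : List F.Carrier) →
                  Any (λ b → ¬ (b F.≈ F.0#)) P × (evalPoly (map φ P) y K.≈ K.0#)

-- Laurent polynomials in m variables over a field F: lists of terms
-- (coefficient , exponent vector in ℤ^m).

Exp : ℕ → Set
Exp m = Fin m → ℤ

module Laurent {c ℓ} (F : Field c ℓ) where
  open Field F using (Carrier; 0#; 1#; _+_; _*_; -_; _⁻¹)

  Term : ℕ → Set c
  Term m = Carrier × Exp m

  LPoly : ℕ → Set c
  LPoly m = List (Term m)

  natMul : ℕ → Carrier
  natMul zero    = 0#
  natMul (suc n) = 1# + natMul n

  fromℤ : ℤ → Carrier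
  fromℤ (+ n)     = natMul n
  fromℤ -[1+ n ]  = - natMul (suc n)

  natPow : Carrier → ℕ → Carrier
  natPow x zero    = 1#
  natPow x (suc n) = x * natPow x n

  -- integer powers (meaningful for x ≠ 0)
  intPow : Carrier → ℤ → Carrier
  intPow x (+ n)    = natPow x n
  intPow x -[1+ n ] = natPow (x ⁻¹) (suc n)

  finProd : ∀ {m} → (Fin m → Carrier) → Carrier
  finProd {zero}  g = 1#
  finProd {suc m} g = g zero * finProd (λ i → g (suc i))

  finSum : ∀ {m} → (Fin m → Carrier) → Carrier
  finSum {zero}  g = 0#
  finSum {suc m} g = g zero + finSum (λ i → g (suc i))

  monomial : ∀ {m} → Exp m → (Fin m → Carrier) → Carrier
  monomial e x = finProd (λ j → intPow (x j) (e j))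

  evalL : ∀ {m} → LPoly m → (Fin m → Carrier) → Carrier
  evalL P x = foldr (λ t acc → (proj₁ t * monomial (proj₂ t) x) + acc) 0# P

  ∂ : ∀ {m} → Fin m → LPoly m → LPoly m
  ∂ j = map (λ t → ( fromℤ (proj₂ t j) * proj₁ t
                   , λ k → if does (k Fin.≟ j) then proj₂ t k ℤ.- ℤ.1ℤ else proj₂ t k))

  mapCoeff : ∀ {c' ℓ'} (K : Field c' ℓ') → (Carrier → Field.Carrier K) →
             ∀ {m} → LPoly m → List (Field.Carrier K × Exp m)
  mapCoeff K φ = map (λ t → φ (proj₁ t) , proj₂ t)

-- Faces of the Newton polyhedron Δ(f) = conv({0} ∪ supp f).
-- A (nonempty, closed) face of a lattice polytope is the set of points
-- minimizing a linear functional w; w = 0 gives Δ itself.  Integral w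
-- suffice since Δ is a lattice polytope.

dot : ∀ {m} → Exp m → Exp m → ℤ
dot {zero}  w e = ℤ.0ℤ
dot {suc m} w e = (w zero ℤ.* e zero) ℤ.+ dot (λ i → w (suc i)) (λ i → e (suc i))

origin : ∀ {m} → Exp m
origin _ = ℤ.0ℤ

module Newton {c ℓ} (F : Field c ℓ) where
  open Laurent F

  spanning : ∀ {m} → LPoly m → List (Exp m)
  spanning P = origin ∷ map proj₂ P

  InFace : ∀ {m} → Exp m → LPoly m → Exp m → Set
  InFace w P v = All (λ u → dot w v ℤ.≤ dot w u) (spanning P)

  inFace? : ∀ {m} (w : Exp m) (P : LPoly m) (v : Exp m) → Dec (InFace w P v)
  inFace? w P v = all? (λ u → dot w v ℤ.≤? dot w u) (spanning P)

  restrict : ∀ {m} → Exp m → LPoly m → LPoly m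
  restrict w P = filter (λ t → inFace? w P (proj₂ t)) P

  NonDegenerate : ∀ {c' ℓ'} (K : Field c' ℓ') → (Field.Carrier F → Field.Carrier K) →
                  ∀ {m} → LPoly m → Set (c' ⊔ ℓ')
  NonDegenerate K φ {m} P =
    ∀ (w : Exp m) → ¬ InFace w P origin →
      ¬ (∃ λ (x : Fin m → K.Carrier) →
           (∀ j → ¬ (x j K.≈ K.0#)) ×
           (∀ j → Laurent.evalL K (mapCoeff K φ (∂ j (restrict w P))) x K.≈ K.0#))
    where module K = Field K

-- The specific polynomial of the theorem, in variables x_1..x_{n+1}
-- (indices 0..n; x_{n+1} is index fromℕ n):
-- f = Σ_{i≤n} a_i x_{n+1}(x_i + x_i⁻¹) + a_{n+1} x_{n+1} + x_{n+1}⁻¹.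

unit : ∀ {m} → Fin m → ℤ → Exp m
unit j k i = if does (i Fin.≟ j) then k else ℤ.0ℤ

addE : ∀ {m} → Exp m → Exp m → Exp m
addE e e' i = e i ℤ.+ e' i

allFinList : ∀ n → List (Fin n)
allFinList zero    = []
allFinList (suc n) = zero ∷ map suc (allFinList n)

module Example {c ℓ} (F : Field c ℓ) where
  open Field F using (Carrier; 0#; 1#; _+_; _*_; -_)
  open Laurent F

  fPoly : ∀ n → (Fin (suc n) → Carrier) → LPoly (suc n)
  fPoly n a =
    concatMap (λ i →
        (a (inject₁ i) , addE (unit (inject₁ i) (+ 1)) (unit (fromℕ n) (+ 1)))
      ∷ (a (inject₁ i) , addE (unit (inject₁ i) ℤ.-1ℤ) (unit (fromℕ n) (+ 1)))
      ∷ []) (allFinList n)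
    Data.List.++
    ( (a (fromℕ n) , unit (fromℕ n) (+ 1))
    ∷ (1# , unit (fromℕ n) ℤ.-1ℤ)
    ∷ [])
    where import Data.List

  -- all sign vectors (c_1..c_n) ∈ {±1}^n  (true = +1, false = -1)
  signVecs : ∀ n → List (Vec Bool n)
  signVecs zero    = [] ∷ []
  signVecs (suc n) = concatMap (λ v → (true ∷ v) ∷ (false ∷ v) ∷ []) (signVecs n)

  two : Carrier
  two = 1# + 1#

  factor : ∀ n → (Fin (suc n) → Carrier) → Vec Bool n → Carrier
  factor n a s =
    finSum (λ i → (if Data.Vec.lookup s i then two else - two) * a (inject₁ i))
      + a (fromℕ n)
    where import Data.Vec

  signProduct : ∀ n → (Fin (suc n) → Carrier) → Carrier
  signProduct n a = foldr (λ s acc → factor n a s * acc) 1# (signVecs n)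

module Submission where

-- Write f = Σᵢ (Aᵢ⁺ + Aᵢ⁻) + B + C, Aᵢ± = aᵢ xᵢ^{±1} x_{n+1}, B = a_{n+1} x_{n+1},
-- C = x_{n+1}⁻¹.  On the torus, xⱼ ∂ⱼ f^δ(x) = Σ_{t ∈ δ} eₜ(j) t(x) (Euler), so a
-- common zero of the derivatives of f^δ is a common zero of these weighted sums.
-- Since w·Aᵢ⁺ + w·Aᵢ⁻ = 2 w·B and w·B + w·C = 0, a face δ avoiding the origin is
--   (a) one containing exactly one Aᵢ±: then xᵢ∂ᵢ f^δ(x) = ±Aᵢ±(x) ≠ 0;
--   (b) δ = {Aᵢ±, B}: the equations read xᵢ² = 1, i.e. xᵢ = cᵢ = ±1, and
--       Σᵢ aᵢ(xᵢ + xᵢ⁻¹) + a_{n+1} = Σᵢ 2cᵢaᵢ + a_{n+1} = 0;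
--   (c) δ = {C}: then x_{n+1}∂_{n+1} f^δ(x) = −C(x) ≠ 0.
-- Hence a nonzero sign product gives non-degeneracy; conversely a vanishing
-- factor for the signs c makes (c, 1) a common zero on the face (b), cut out by
-- w = −e_{n+1}.  Only "φ : F → K is a ring homomorphism of fields" is used.

open import Defs
open import Algebra.Morphism.Structures using (module RingMorphisms)
open import Data.Nat as ℕ using (ℕ; zero; suc)
import Data.Nat.Properties as ℕP
open import Data.Integer as ℤ using (ℤ; +_; -[1+_]; 0ℤ; 1ℤ; -1ℤ)
import Data.Integer.Properties as ℤP
open import Data.Integer.Solver using (module +-*-Solver)
open import Data.Fin as Fin using (Fin; zero; suc; inject₁; fromℕ)
import Data.Fin.Properties as FinP
open import Data.Fin.Relation.Unary.Top using (view; ‵fromℕ; ‵inject₁)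
open import Data.Bool using (Bool; true; false; if_then_else_)
open import Data.Vec as Vec using (Vec; []; _∷_)
open import Data.List as List using (List; []; _∷_; _++_; concatMap; filter; map; foldr)
import Data.List.Properties as ListP
open import Data.List.Relation.Unary.All as All using (All; []; _∷_)
import Data.List.Relation.Unary.All.Properties as AllP
open import Data.List.Relation.Unary.Any using (here; there)
open import Data.List.Membership.Propositional using (_∈_; lose)
open import Data.List.Membership.Propositional.Properties using (∈-concatMap⁺)
open import Data.Product using (∃; _×_; _,_; proj₁; proj₂)
open import Data.Sum using (_⊎_; inj₁; inj₂)
open import Data.Empty using (⊥; ⊥-elim)
open import Relation.Nullary using (¬_; Dec; yes; no; does)
open import Relation.Nullary.Decidable using (_⊎-dec_)
open import Relation.Binary.PropositionalEquality as ≡ using (_≡_; _≢_)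
open import Function.Bundles using (_⇔_; mk⇔)

module FieldFacts {c ℓ} (F : Field c ℓ) where
  open Field F
  open import Algebra.Properties.Ring ring public
  open import Relation.Binary.Reasoning.Setoid setoid

  1≉0 : ¬ 1# ≈ 0#
  1≉0 h = 0≉1 (sym h)

  ⁻¹-inverseˡ : ∀ x → ¬ x ≈ 0# → (x ⁻¹) * x ≈ 1#
  ⁻¹-inverseˡ x x≉0 = trans (*-comm _ _) (⁻¹-inverse x x≉0)

  nonzero-cancel : ∀ {x y} → ¬ x ≈ 0# → x * y ≈ 0# → y ≈ 0#
  nonzero-cancel {x} {y} x≉0 xy≈0 = begin
    y                 ≈⟨ *-identityˡ y ⟨
    1# * y            ≈⟨ *-congʳ (⁻¹-inverseˡ x x≉0) ⟨
    ((x ⁻¹) * x) * y  ≈⟨ *-assoc _ _ _ ⟩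
    (x ⁻¹) * (x * y)  ≈⟨ *-congˡ xy≈0 ⟩
    (x ⁻¹) * 0#       ≈⟨ zeroʳ _ ⟩
    0#                ∎

  *-nonzero : ∀ {x y} → ¬ x ≈ 0# → ¬ y ≈ 0# → ¬ (x * y) ≈ 0#
  *-nonzero x≉0 y≉0 xy≈0 = y≉0 (nonzero-cancel x≉0 xy≈0)

  ⁻¹-nonzero : ∀ {x} → ¬ x ≈ 0# → ¬ (x ⁻¹) ≈ 0#
  ⁻¹-nonzero {x} x≉0 x⁻¹≈0 =
    0≉1 (trans (sym (zeroʳ x)) (trans (*-congˡ (sym x⁻¹≈0)) (⁻¹-inverse x x≉0)))

  -‿zero : ∀ {x} → x ≈ 0# → - x ≈ 0#
  -‿zero x≈0 = trans (-‿cong x≈0) -0#≈0#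

  -‿nonzero : ∀ {x} → ¬ x ≈ 0# → ¬ (- x) ≈ 0#
  -‿nonzero {x} x≉0 -x≈0 = x≉0 (trans (sym (-‿involutive x)) (-‿zero -x≈0))

  *-cancelˡ-nonzero : ∀ {x y z} → ¬ x ≈ 0# → x * y ≈ x * z → y ≈ z
  *-cancelˡ-nonzero {x} {y} {z} x≉0 xy≈xz = x∙y⁻¹≈ε⇒x≈y y z
    (nonzero-cancel x≉0 (trans (x[y-z]≈xy-xz x y z) (x≈y⇒x∙y⁻¹≈ε xy≈xz)))

  self-inverse : ∀ {z} → ¬ z ≈ 0# → z * z ≈ 1# → z ⁻¹ ≈ z
  self-inverse {z} z≉0 z²≈1 = *-cancelˡ-nonzero z≉0 (trans (⁻¹-inverse z z≉0) (sym z²≈1))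

  difference-of-squares : ∀ x → (x - 1#) * (x + 1#) ≈ x * x - 1#
  difference-of-squares x = begin
    (x - 1#) * (x + 1#)            ≈⟨ [y-z]x≈yx-zx (x + 1#) x 1# ⟩
    x * (x + 1#) - 1# * (x + 1#)   ≈⟨ +-cong (distribˡ x x 1#) (-‿cong (*-identityˡ _)) ⟩
    (x * x + x * 1#) - (x + 1#)    ≈⟨ +-cong (+-congˡ (*-identityʳ x)) (sym (-‿+-comm x 1#)) ⟩
    (x * x + x) + (- x + - 1#)     ≈⟨ +-assoc _ _ _ ⟩
    x * x + (x + (- x + - 1#))     ≈⟨ +-congˡ (sym (+-assoc _ _ _)) ⟩
    x * x + ((x - x) + - 1#)       ≈⟨ +-congˡ (+-congʳ (-‿inverseʳ x)) ⟩
    x * x + (0# + - 1#)            ≈⟨ +-congˡ (+-identityˡ _) ⟩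
    x * x - 1#                     ∎

  -- x² = 1 forces x = ±1; equality in F is not decidable, so constructively
  -- this only holds up to double negation, which suffices to reach ⊥.
  square≈1⇒±1 : ∀ {x} → x * x ≈ 1# → ¬ ¬ (x ≈ 1# ⊎ x ≈ - 1#)
  square≈1⇒±1 {x} x²≈1 neither = neither (inj₂ (+-inverseˡ-unique x 1#
    (nonzero-cancel (λ x-1≈0 → neither (inj₁ (x∙y⁻¹≈ε⇒x≈y x 1# x-1≈0)))
                    (trans (difference-of-squares x) (x≈y⇒x∙y⁻¹≈ε x²≈1)))))

  sign : Bool → Carrier
  sign true  = 1#
  sign false = - 1#

  sign² : ∀ b → sign b * sign b ≈ 1#
  sign² true  = *-identityˡ _
  sign² false = trans (-1*x≈-x _) (-‿involutive _)

  sign-nonzero : ∀ b → ¬ sign b ≈ 0#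
  sign-nonzero true  = 1≉0
  sign-nonzero false = -‿nonzero 1≉0

module MonomialFacts {c ℓ} (K : Field c ℓ) where
  open Field K hiding (zero)
  open FieldFacts K
  open Laurent K
  open import Relation.Binary.Reasoning.Setoid setoid

  natPow-nonzero : ∀ {x} → ¬ x ≈ 0# → ∀ k → ¬ natPow x k ≈ 0#
  natPow-nonzero x≉0 zero    = 1≉0
  natPow-nonzero x≉0 (suc k) = *-nonzero x≉0 (natPow-nonzero x≉0 k)

  intPow-nonzero : ∀ {x} → ¬ x ≈ 0# → ∀ k → ¬ intPow x k ≈ 0#
  intPow-nonzero x≉0 (+ k)    = natPow-nonzero x≉0 k
  intPow-nonzero x≉0 -[1+ k ] = natPow-nonzero (⁻¹-nonzero x≉0) (suc k)

  intPow-pred : ∀ {x} → ¬ x ≈ 0# → ∀ k → intPow x (k ℤ.- 1ℤ) ≈ intPow x k * (x ⁻¹)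
  intPow-pred {x} x≉0 (+ zero)  = *-comm _ _
  intPow-pred {x} x≉0 (+ suc k) = begin
    natPow x k                  ≈⟨ *-identityˡ _ ⟨
    1# * natPow x k             ≈⟨ *-congʳ (⁻¹-inverseˡ x x≉0) ⟨
    ((x ⁻¹) * x) * natPow x k   ≈⟨ *-assoc _ _ _ ⟩
    (x ⁻¹) * (x * natPow x k)   ≈⟨ *-comm _ _ ⟩
    (x * natPow x k) * (x ⁻¹)   ∎
  intPow-pred {x} x≉0 -[1+ k ] rewrite ℕP.+-identityʳ k = *-comm _ _

  finProd-cong : ∀ {m} {g h : Fin m → Carrier} → (∀ i → g i ≈ h i) → finProd g ≈ finProd h
  finProd-cong {zero}  g≈h = refl
  finProd-cong {suc m} g≈h = *-cong (g≈h zero) (finProd-cong (λ i → g≈h (suc i)))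

  finProd-nonzero : ∀ {m} {g : Fin m → Carrier} → (∀ i → ¬ g i ≈ 0#) → ¬ finProd g ≈ 0#
  finProd-nonzero {zero}  g≉0 = 1≉0
  finProd-nonzero {suc m} g≉0 = *-nonzero (g≉0 zero) (finProd-nonzero (λ i → g≉0 (suc i)))

  finProd-ones : ∀ {m} → finProd {m} (λ _ → 1#) ≈ 1#
  finProd-ones {zero}  = refl
  finProd-ones {suc m} = trans (*-identityˡ _) (finProd-ones {m})

  scaleAt : ∀ {m} → (Fin m → Carrier) → Fin m → Carrier → Fin m → Carrier
  scaleAt g j v i = if does (i Fin.≟ j) then g i * v else g i

  finProd-scaleAt : ∀ {m} (g h : Fin m → Carrier) (j : Fin m) (v : Carrier) →
    (∀ i → h i ≈ scaleAt g j v i) → finProd h ≈ finProd g * v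
  finProd-scaleAt {suc m} g h zero v h≈ = begin
    h zero * finProd (λ i → h (suc i))        ≈⟨ *-cong (h≈ zero) (finProd-cong (λ i → h≈ (suc i))) ⟩
    (g zero * v) * finProd (λ i → g (suc i))  ≈⟨ *-assoc _ _ _ ⟩
    g zero * (v * finProd (λ i → g (suc i)))  ≈⟨ *-congˡ (*-comm _ _) ⟩
    g zero * (finProd (λ i → g (suc i)) * v)  ≈⟨ *-assoc _ _ _ ⟨
    (g zero * finProd (λ i → g (suc i))) * v  ∎
  finProd-scaleAt {suc m} g h (suc j) v h≈ = begin
    h zero * finProd (λ i → h (suc i))
      ≈⟨ *-cong (h≈ zero) (finProd-scaleAt (λ i → g (suc i)) (λ i → h (suc i)) j v (λ i → h≈ (suc i))) ⟩
    g zero * (finProd (λ i → g (suc i)) * v)  ≈⟨ *-assoc _ _ _ ⟨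
    (g zero * finProd (λ i → g (suc i))) * v  ∎

  lowerAt : ∀ {m} → Fin m → Exp m → Exp m
  lowerAt j e k = if does (k Fin.≟ j) then e k ℤ.- 1ℤ else e k

  monomial-lowerAt : ∀ {m} (x : Fin m → Carrier) → (∀ j → ¬ x j ≈ 0#) → ∀ (e : Exp m) j →
    monomial (lowerAt j e) x ≈ monomial e x * (x j ⁻¹)
  monomial-lowerAt x x≉0 e j = finProd-scaleAt _ _ j _ entry
    where
    entry : ∀ i → intPow (x i) (lowerAt j e i) ≈ scaleAt (λ k → intPow (x k) (e k)) j (x j ⁻¹) i
    entry i with i Fin.≟ j
    ... | yes ≡.refl = intPow-pred (x≉0 i) (e i)
    ... | no _       = refl

  monomial-unit : ∀ {m} (x : Fin m → Carrier) (j : Fin m) k →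
    monomial (unit j k) x ≈ intPow (x j) k
  monomial-unit {m} x j k =
    trans (finProd-scaleAt (λ _ → 1#) _ j (intPow (x j) k) entry)
          (trans (*-congʳ (finProd-ones {m})) (*-identityˡ _))
    where
    entry : ∀ i → intPow (x i) (unit j k i) ≈ scaleAt (λ _ → 1#) j (intPow (x j) k) i
    entry i with i Fin.≟ j
    ... | yes ≡.refl = sym (*-identityˡ _)
    ... | no _       = refl

  monomial-addUnit : ∀ {m} (x : Fin m → Carrier) (e : Exp m) (j : Fin m) k → e j ≡ 0ℤ →
    monomial (addE (unit j k) e) x ≈ monomial e x * intPow (x j) k
  monomial-addUnit x e j k ej≡0 = finProd-scaleAt _ _ j (intPow (x j) k) entry
    where
    entry : ∀ i → intPow (x i) (addE (unit j k) e i) ≈ scaleAt (λ i → intPow (x i) (e i)) j (intPow (x j) k) i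
    entry i with i Fin.≟ j
    ... | yes ≡.refl rewrite ej≡0 | ℤP.+-identityʳ k = sym (*-identityˡ _)
    ... | no _ rewrite ℤP.+-identityˡ (e i) = refl

  x¹≈x⁻¹⇒x²≈1 : ∀ {z} → ¬ z ≈ 0# → intPow z (+ 1) ≈ intPow z -1ℤ → z * z ≈ 1#
  x¹≈x⁻¹⇒x²≈1 {z} z≉0 z¹≈z⁻¹ =
    trans (*-congˡ (trans (sym (*-identityʳ z)) (trans z¹≈z⁻¹ (*-identityʳ _)))) (⁻¹-inverse z z≉0)

  x²≈1⇒x¹≈x⁻¹ : ∀ {z} → ¬ z ≈ 0# → z * z ≈ 1# → intPow z (+ 1) ≈ intPow z -1ℤ
  x²≈1⇒x¹≈x⁻¹ z≉0 z²≈1 = *-congʳ (sym (self-inverse z≉0 z²≈1))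

  finSum-cong : ∀ {m} {g h : Fin m → Carrier} → (∀ i → g i ≈ h i) → finSum g ≈ finSum h
  finSum-cong {zero}  g≈h = refl
  finSum-cong {suc m} g≈h = +-cong (g≈h zero) (finSum-cong (λ i → g≈h (suc i)))

  finSum-zeros : ∀ {m} → finSum {m} (λ _ → 0#) ≈ 0#
  finSum-zeros {zero}  = refl
  finSum-zeros {suc m} = trans (+-identityˡ _) (finSum-zeros {m})

  finSum-single : ∀ {m} (g : Fin m → Carrier) (j : Fin m) → (∀ i → i ≢ j → g i ≈ 0#) →
    finSum g ≈ g j
  finSum-single {suc m} g zero others =
    trans (+-congˡ (trans (finSum-cong (λ i → others (suc i) (λ ()))) (finSum-zeros {m}))) (+-identityʳ _)
  finSum-single {suc m} g (suc j) others =
    trans (+-congʳ (others zero (λ ())))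
      (trans (+-identityˡ _)
        (finSum-single (λ i → g (suc i)) j (λ i i≢j → others (suc i) (λ eq → i≢j (FinP.suc-injective eq)))))

  finSum-*ʳ : ∀ {m} (g : Fin m → Carrier) v → finSum (λ i → g i * v) ≈ finSum g * v
  finSum-*ʳ {zero}  g v = sym (zeroˡ v)
  finSum-*ʳ {suc m} g v = trans (+-congˡ (finSum-*ʳ (λ i → g (suc i)) v)) (sym (distribʳ v _ _))

module ExponentFacts where
  open import Data.Integer using (_+_; _*_; -_; _≤_)

  unit-same : ∀ {m} (j : Fin m) k → unit j k j ≡ k
  unit-same j k with j Fin.≟ j
  ... | yes _  = ≡.refl
  ... | no j≢j = ⊥-elim (j≢j ≡.refl)

  unit-other : ∀ {m} {i j : Fin m} k → i ≢ j → unit j k i ≡ 0ℤ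
  unit-other {i = i} {j} k i≢j with i Fin.≟ j
  ... | yes i≡j = ⊥-elim (i≢j i≡j)
  ... | no _    = ≡.refl

  dot-origin : ∀ {m} (w : Exp m) → dot w origin ≡ 0ℤ
  dot-origin {zero}  w = ≡.refl
  dot-origin {suc m} w rewrite ℤP.*-zeroʳ (w zero) =
    ≡.trans (ℤP.+-identityˡ _) (dot-origin (λ i → w (suc i)))

  dot-unit : ∀ {m} (w : Exp m) (j : Fin m) k → dot w (unit j k) ≡ w j * k
  dot-unit {suc m} w zero k rewrite dot-origin (λ i → w (suc i)) = ℤP.+-identityʳ _
  dot-unit {suc m} w (suc j) k rewrite ℤP.*-zeroʳ (w zero) =
    ≡.trans (ℤP.+-identityˡ _) (dot-unit (λ i → w (suc i)) j k)

  dot-addE : ∀ {m} (w e e′ : Exp m) → dot w (addE e e′) ≡ dot w e + dot w e′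
  dot-addE {zero}  w e e′ = ≡.refl
  dot-addE {suc m} w e e′
    rewrite dot-addE (λ i → w (suc i)) (λ i → e (suc i)) (λ i → e′ (suc i)) =
    solve 5 (λ a b c d f → a :* (b :+ c) :+ (d :+ f) := (a :* b :+ d) :+ (a :* c :+ f)) ≡.refl
      (w zero) (e zero) (e′ zero)
      (dot (λ i → w (suc i)) (λ i → e (suc i))) (dot (λ i → w (suc i)) (λ i → e′ (suc i)))
    where open +-*-Solver

  +-cancelʳ-≤ : ∀ {a b t} → a + t ≤ b + t → a ≤ b
  +-cancelʳ-≤ {a} {b} {t} a+t≤b+t = ≡.subst₂ _≤_ (cancel a) (cancel b) (ℤP.+-monoˡ-≤ (- t) a+t≤b+t)
    where
    cancel : ∀ z → z + t + - t ≡ z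
    cancel z = ≡.trans (ℤP.+-assoc z t (- t))
                 (≡.trans (≡.cong (λ s → z + s) (ℤP.+-inverseʳ t)) (ℤP.+-identityʳ z))

  balanced-above : ∀ {u t} → t ≤ u + t → t ≤ - u + t → u ≡ 0ℤ
  balanced-above {u} {t} t≤u+t t≤-u+t = ℤP.≤-antisym
    (ℤP.neg-cancel-≤ (+-cancelʳ-≤ {0ℤ} (≡.subst (_≤ - u + t) (≡.sym (ℤP.+-identityˡ t)) t≤-u+t)))
    (+-cancelʳ-≤ {0ℤ} (≡.subst (_≤ u + t) (≡.sym (ℤP.+-identityˡ t)) t≤u+t))

  balanced-below : ∀ {u t} → u + t ≤ t → - u + t ≤ t → u ≡ 0ℤ
  balanced-below {u} {t} u+t≤t -u+t≤t = ℤP.≤-antisym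
    (+-cancelʳ-≤ {u} {0ℤ} (≡.subst (u + t ≤_) (≡.sym (ℤP.+-identityˡ t)) u+t≤t))
    (ℤP.neg-cancel-≤ {u} {0ℤ} (+-cancelʳ-≤ { - u} {0ℤ} (≡.subst (- u + t ≤_) (≡.sym (ℤP.+-identityˡ t)) -u+t≤t)))

module FaceFacts {c ℓ} (F : Field c ℓ) where
  open Newton F
  open Laurent F using (LPoly)

  sameWeight : ∀ {m} (w : Exp m) (P : LPoly m) {v v′} →
    dot w v′ ≡ dot w v → InFace w P v → InFace w P v′
  sameWeight w P v′≡v = All.map (ℤP.≤-trans (ℤP.≤-reflexive v′≡v))

  faceVertex : ∀ {m} (w : Exp m) (P : LPoly m) → ∃ λ v → v ∈ spanning P × InFace w P v
  faceVertex w P = argmin (dot w) origin (map proj₂ P)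
    where
    argmin : ∀ {X : Set} (g : X → ℤ) (x : X) (xs : List X) →
      ∃ λ v → v ∈ (x ∷ xs) × All (λ y → g v ℤ.≤ g y) (x ∷ xs)
    argmin g x [] = x , here ≡.refl , (ℤP.≤-refl ∷ [])
    argmin g x (y ∷ ys) with argmin g y ys
    ... | v , v∈ , v-min with g x ℤ.≤? g v
    ...   | yes x≤v = x , here ≡.refl , (ℤP.≤-refl ∷ All.map (ℤP.≤-trans x≤v) v-min)
    ...   | no x≰v  = v , there v∈ , (ℤP.<⇒≤ (ℤP.≰⇒> x≰v) ∷ v-min)

module Derivatives {c ℓ c′ ℓ′} (F : Field c ℓ) (K : Field c′ ℓ′)
    (φ : Field.Carrier F → Field.Carrier K)
    (hom : RingMorphisms.IsRingHomomorphism (Field.rawRing F) (Field.rawRing K) φ) where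
  private
    module F  = Field F
    module LF = Laurent F
  open Field K hiding (zero)
  open FieldFacts K
  open MonomialFacts K
  open Laurent K using (monomial; finSum; evalL)
  open RingMorphisms.IsRingHomomorphism hom
  open import Relation.Binary.Reasoning.Setoid setoid

  φ-nonzero : ∀ {b} → ¬ b F.≈ F.0# → ¬ φ b ≈ 0#
  φ-nonzero {b} b≉0 φb≈0 = 0≉1 (begin
    0#                    ≈⟨ zeroˡ _ ⟨
    0# * φ (b F.⁻¹)       ≈⟨ *-congʳ φb≈0 ⟨
    φ b * φ (b F.⁻¹)      ≈⟨ *-homo b (b F.⁻¹) ⟨
    φ (b F.* (b F.⁻¹))    ≈⟨ ⟦⟧-cong (F.⁻¹-inverse b b≉0) ⟩
    φ F.1#                ≈⟨ 1#-homo ⟩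
    1#                    ∎)

  φ-finSum : ∀ {m} (g : Fin m → F.Carrier) → φ (LF.finSum g) ≈ finSum (λ i → φ (g i))
  φ-finSum {zero}  g = 0#-homo
  φ-finSum {suc m} g = trans (+-homo _ _) (+-congˡ (φ-finSum (λ i → g (suc i))))

  φ-scale-0 : ∀ b → φ (LF.fromℤ 0ℤ F.* b) ≈ 0#
  φ-scale-0 b = trans (⟦⟧-cong (F.zeroˡ b)) 0#-homo

  φ-scale-1 : ∀ b → φ (LF.fromℤ (+ 1) F.* b) ≈ φ b
  φ-scale-1 b = ⟦⟧-cong (F.trans (F.*-congʳ (F.+-identityʳ F.1#)) (F.*-identityˡ b))

  φ-scale-−1 : ∀ b → φ (LF.fromℤ -1ℤ F.* b) ≈ - φ b
  φ-scale-−1 b = trans (⟦⟧-cong (F.trans (F.*-congʳ (F.-‿cong (F.+-identityʳ F.1#)))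
                                          (FieldFacts.-1*x≈-x F b)))
                       (-‿homo b)

  sumOver : ∀ {a} {A : Set a} → (A → Carrier) → List A → Carrier
  sumOver g = foldr (λ t acc → g t + acc) 0#

  sumOver-cong : ∀ {a} {A : Set a} {g h : A → Carrier} L → (∀ t → g t ≈ h t) →
    sumOver g L ≈ sumOver h L
  sumOver-cong []      g≈h = refl
  sumOver-cong (t ∷ L) g≈h = +-cong (g≈h t) (sumOver-cong L g≈h)

  sumOver-++ : ∀ {a} {A : Set a} (g : A → Carrier) L L′ →
    sumOver g (L ++ L′) ≈ sumOver g L + sumOver g L′
  sumOver-++ g []      L′ = sym (+-identityˡ _)
  sumOver-++ g (t ∷ L) L′ = trans (+-congˡ (sumOver-++ g L L′)) (sym (+-assoc _ _ _))

  sumOver-*ʳ : ∀ {a} {A : Set a} (g : A → Carrier) L v →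
    sumOver (λ t → g t * v) L ≈ sumOver g L * v
  sumOver-*ʳ g []      v = sym (zeroˡ v)
  sumOver-*ʳ g (t ∷ L) v = trans (+-congˡ (sumOver-*ʳ g L v)) (sym (distribʳ v _ _))

  sumOver-concatMap : ∀ {a} {A : Set a} {m} (g : A → Carrier) (G : Fin m → List A) →
    sumOver g (concatMap G (allFinList m)) ≈ finSum (λ i → sumOver g (G i))
  sumOver-concatMap {m = zero}  g G = refl
  sumOver-concatMap {m = suc m} g G = begin
    sumOver g (G zero ++ List.concat (map G (map suc (allFinList m))))
      ≈⟨ sumOver-++ g (G zero) _ ⟩
    sumOver g (G zero) + sumOver g (List.concat (map G (map suc (allFinList m))))
      ≡⟨ ≡.cong (λ L → sumOver g (G zero) + sumOver g (List.concat L)) (≡.sym (ListP.map-∘ (allFinList m))) ⟩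
    sumOver g (G zero) + sumOver g (concatMap (λ i → G (suc i)) (allFinList m))
      ≈⟨ +-congˡ (sumOver-concatMap g (λ i → G (suc i))) ⟩
    finSum (λ i → sumOver g (G i)) ∎

  when : ∀ {p} {Q : Set p} → Dec Q → Carrier → Carrier
  when d v = if does d then v else 0#

  when-yes : ∀ {p} {Q : Set p} (d : Dec Q) {v} → Q → when d v ≈ v
  when-yes (yes _) q = refl
  when-yes (no ¬q) q = ⊥-elim (¬q q)

  when-no : ∀ {p} {Q : Set p} (d : Dec Q) {v} → ¬ Q → when d v ≈ 0#
  when-no (yes q) ¬q = ⊥-elim (¬q q)
  when-no (no _)  ¬q = refl

  when-cong : ∀ {p} {Q : Set p} (d : Dec Q) {v v′} → v ≈ v′ → when d v ≈ when d v′
  when-cong (yes _) v≈v′ = v≈v′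
  when-cong (no _)  v≈v′ = refl

  when-zero : ∀ {p} {Q : Set p} (d : Dec Q) {v} → v ≈ 0# → when d v ≈ 0#
  when-zero (yes _) v≈0 = v≈0
  when-zero (no _)  v≈0 = refl

  when-neg : ∀ {p} {Q : Set p} (d : Dec Q) {v} → when d (- v) ≈ - when d v
  when-neg (yes _) = refl
  when-neg (no _)  = sym -0#≈0#

  sumOver-filter : ∀ {a p} {A : Set a} {Q : A → Set p} (Q? : ∀ t → Dec (Q t)) g L →
    sumOver g (filter Q? L) ≈ sumOver (λ t → when (Q? t) (g t)) L
  sumOver-filter Q? g [] = refl
  sumOver-filter Q? g (t ∷ L) with Q? t
  ... | yes _ = +-congˡ (sumOver-filter Q? g L)
  ... | no _  = trans (sumOver-filter Q? g L) (sym (+-identityˡ _))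

  module AtPoint {m} (x : Fin m → Carrier) (x≉0 : ∀ j → ¬ x j ≈ 0#) where

    value : LF.Term m → Carrier
    value t = φ (proj₁ t) * monomial (proj₂ t) x

    weighted : Fin m → LF.Term m → Carrier
    weighted j t = φ (LF.fromℤ (proj₂ t j) F.* proj₁ t) * monomial (proj₂ t) x

    ∂at : Fin m → LF.LPoly m → Carrier
    ∂at j L = evalL (LF.mapCoeff K φ (LF.∂ j L)) x

    euler : ∀ j L → ∂at j L ≈ sumOver (weighted j) L * (x j ⁻¹)
    euler j L = trans (unfold L) (trans (sumOver-cong L lower) (sumOver-*ʳ (weighted j) L (x j ⁻¹)))
      where
      unfold : ∀ L → ∂at j L ≈
        sumOver (λ t → φ (LF.fromℤ (proj₂ t j) F.* proj₁ t) * monomial (lowerAt j (proj₂ t)) x) L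
      unfold []      = refl
      unfold (t ∷ L) = +-congˡ (unfold L)
      lower : ∀ t → φ (LF.fromℤ (proj₂ t j) F.* proj₁ t) * monomial (lowerAt j (proj₂ t)) x
                    ≈ weighted j t * (x j ⁻¹)
      lower t = trans (*-congˡ (monomial-lowerAt x x≉0 (proj₂ t) j)) (sym (*-assoc _ _ _))

    ∂at-zero⇒ : ∀ j L → ∂at j L ≈ 0# → sumOver (weighted j) L ≈ 0#
    ∂at-zero⇒ j L ∂≈0 =
      nonzero-cancel (⁻¹-nonzero (x≉0 j)) (trans (*-comm _ _) (trans (sym (euler j L)) ∂≈0))

    ⇒∂at-zero : ∀ j L → sumOver (weighted j) L ≈ 0# → ∂at j L ≈ 0#
    ⇒∂at-zero j L S≈0 = trans (euler j L) (trans (*-congʳ S≈0) (zeroˡ _))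

    exponentFactor : ∀ {k k′} b → k ≡ k′ → φ (LF.fromℤ k F.* b) ≈ φ (LF.fromℤ k′ F.* b)
    exponentFactor b k≡k′ = reflexive (≡.cong (λ k → φ (LF.fromℤ k F.* b)) k≡k′)

    weighted-0 : ∀ j t → proj₂ t j ≡ 0ℤ → weighted j t ≈ 0#
    weighted-0 j (b , e) ej≡0 = trans (*-congʳ (trans (exponentFactor b ej≡0) (φ-scale-0 b))) (zeroˡ _)

    weighted-1 : ∀ j t → proj₂ t j ≡ + 1 → weighted j t ≈ value t
    weighted-1 j (b , e) ej≡1 = *-congʳ (trans (exponentFactor b ej≡1) (φ-scale-1 b))

    weighted-−1 : ∀ j t → proj₂ t j ≡ -1ℤ → weighted j t ≈ - value t
    weighted-−1 j (b , e) ej≡-1 =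
      trans (*-congʳ (trans (exponentFactor b ej≡-1) (φ-scale-−1 b))) (sym (-‿distribˡ-* _ _))

    value-nonzero : ∀ t → ¬ proj₁ t F.≈ F.0# → ¬ value t ≈ 0#
    value-nonzero t c≉0 =
      *-nonzero (φ-nonzero c≉0) (finProd-nonzero (λ j → intPow-nonzero (x≉0 j) (proj₂ t j)))
      where open Laurent K using (intPow)

allFinList⁺ : ∀ {p} {m} {S : Fin m → Set p} → (∀ i → S i) → All S (allFinList m)
allFinList⁺ {m = zero}  s = []
allFinList⁺ {m = suc m} s = s zero ∷ AllP.map⁺ (allFinList⁺ (λ i → s (suc i)))

allFinList⁻ : ∀ {p} {m} {S : Fin m → Set p} → All S (allFinList m) → ∀ i → S i
allFinList⁻ {m = suc m} (s ∷ _)  zero    = s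
allFinList⁻ {m = suc m} (_ ∷ ss) (suc i) = allFinList⁻ (AllP.map⁻ ss) i

module ExampleFaces {c ℓ} (F : Field c ℓ) (n : ℕ) (a : Fin (suc n) → Field.Carrier F) where
  open Newton F
  open FaceFacts F
  open ExponentFacts
  open Laurent F using (Term; LPoly)
  open import Data.Integer using (_+_; -_; _≤_)

  Y : Fin (suc n)
  Y = fromℕ n

  ι : Fin n → Fin (suc n)
  ι = inject₁

  ι≢Y : ∀ i → ι i ≢ Y
  ι≢Y i ιi≡Y = FinP.fromℕ≢inject₁ (≡.sym ιi≡Y)

  eA : Fin n → ℤ → Exp (suc n)
  eA i k = addE (unit (ι i) k) (unit Y (+ 1))

  eB eC : Exp (suc n)
  eB = unit Y (+ 1)
  eC = unit Y -1ℤ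

  eA-ι : ∀ i k → eA i k (ι i) ≡ k
  eA-ι i k rewrite unit-same (ι i) k | unit-other {i = ι i} (+ 1) (ι≢Y i) = ℤP.+-identityʳ k

  eA-ι-other : ∀ {i i′} k → i′ ≢ i → eA i k (ι i′) ≡ 0ℤ
  eA-ι-other {i} {i′} k i′≢i
    rewrite unit-other {i = ι i′} {ι i} k (λ eq → i′≢i (FinP.inject₁-injective eq))
          | unit-other {i = ι i′} (+ 1) (ι≢Y i′) = ≡.refl

  eA-Y : ∀ i k → eA i k Y ≡ + 1
  eA-Y i k rewrite unit-other {i = Y} {ι i} k (λ eq → ι≢Y i (≡.sym eq)) | unit-same Y (+ 1) = ≡.refl

  f : LPoly (suc n)
  f = Example.fPoly F n a

  A⁺ A⁻ : Fin n → Term (suc n)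
  A⁺ i = a (ι i) , eA i (+ 1)
  A⁻ i = a (ι i) , eA i -1ℤ

  B C : Term (suc n)
  B = a Y , eB
  C = Field.1# F , eC

  -- f lists, for each i, the pair Aᵢ⁺, Aᵢ⁻, followed by B and C
  pairA : Fin n → List (Term (suc n))
  pairA i = A⁺ i ∷ A⁻ i ∷ []

  record OnSpanning (R : Exp (suc n) → Set) : Set where
    field
      atOrigin : R origin
      atA⁺     : ∀ i → R (eA i (+ 1))
      atA⁻     : ∀ i → R (eA i -1ℤ)
      atB      : R eB
      atC      : R eC

  allSpanning : ∀ {R} → OnSpanning R → All R (spanning f)
  allSpanning r = atOrigin ∷ AllP.map⁺ (AllP.++⁺ {xs = concatMap pairA (allFinList n)}
      (AllP.concat⁺ (AllP.map⁺ (allFinList⁺ (λ i → atA⁺ i ∷ atA⁻ i ∷ [])))) (atB ∷ atC ∷ []))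
    where open OnSpanning r

  onSpanning : ∀ {R} → All R (spanning f) → OnSpanning R
  onSpanning {R} (r₀ ∷ rs) = record
    { atOrigin = r₀ ; atA⁺ = λ i → proj₁ (atA i) ; atA⁻ = λ i → proj₂ (atA i)
    ; atB = All.head atBC ; atC = All.head (All.tail atBC) }
    where
    split : All (λ t → R (proj₂ t)) (concatMap pairA (allFinList n)) × All (λ t → R (proj₂ t)) (B ∷ C ∷ [])
    split = AllP.++⁻ (concatMap pairA (allFinList n)) (AllP.map⁻ rs)
    atBC : All (λ t → R (proj₂ t)) (B ∷ C ∷ [])
    atBC = proj₂ split
    atA : ∀ i → R (eA i (+ 1)) × R (eA i -1ℤ)
    atA i with allFinList⁻ (AllP.map⁻ (AllP.concat⁻ (proj₁ split))) i
    ... | r⁺ ∷ r⁻ ∷ [] = r⁺ , r⁻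

  module Weights (w : Exp (suc n)) where
    u : Fin n → ℤ
    u i = w (ι i)

    t : ℤ
    t = w Y

    InF : Exp (suc n) → Set
    InF = InFace w f

    dot-A⁺ : ∀ i → dot w (eA i (+ 1)) ≡ u i + t
    dot-A⁺ i rewrite dot-addE w (unit (ι i) (+ 1)) (unit Y (+ 1)) | dot-unit w (ι i) (+ 1)
      | dot-unit w Y (+ 1) | ℤP.*-identityʳ (w (ι i)) | ℤP.*-identityʳ (w Y) = ≡.refl

    dot-A⁻ : ∀ i → dot w (eA i -1ℤ) ≡ - u i + t
    dot-A⁻ i rewrite dot-addE w (unit (ι i) -1ℤ) (unit Y (+ 1)) | dot-unit w (ι i) -1ℤ
      | dot-unit w Y (+ 1) | ℤP.*-comm (w (ι i)) -1ℤ | ℤP.-1*i≡-i (w (ι i))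
      | ℤP.*-identityʳ (w Y) = ≡.refl

    dot-B : dot w eB ≡ t
    dot-B = ≡.trans (dot-unit w Y (+ 1)) (ℤP.*-identityʳ _)

    dot-C : dot w eC ≡ - t
    dot-C = ≡.trans (dot-unit w Y -1ℤ) (≡.trans (ℤP.*-comm _ -1ℤ) (ℤP.-1*i≡-i _))

    record Minimal (z : ℤ) : Set where
      field
        ≤origin : z ≤ 0ℤ
        ≤A⁺     : ∀ i → z ≤ u i + t
        ≤A⁻     : ∀ i → z ≤ - u i + t
        ≤B      : z ≤ t
        ≤C      : z ≤ - t

    minimal : ∀ {v} → InF v → Minimal (dot w v)
    minimal {v} v∈ = record
      { ≤origin = ≡.subst (dot w v ≤_) (dot-origin w) atOrigin
      ; ≤A⁺ = λ i → ≡.subst (dot w v ≤_) (dot-A⁺ i) (atA⁺ i)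
      ; ≤A⁻ = λ i → ≡.subst (dot w v ≤_) (dot-A⁻ i) (atA⁻ i)
      ; ≤B = ≡.subst (dot w v ≤_) dot-B atB
      ; ≤C = ≡.subst (dot w v ≤_) dot-C atC }
      where open OnSpanning (onSpanning v∈)

    minimal⇒InF : ∀ {v} → Minimal (dot w v) → InF v
    minimal⇒InF {v} m = allSpanning record
      { atOrigin = ≡.subst (dot w v ≤_) (≡.sym (dot-origin w)) ≤origin
      ; atA⁺ = λ i → ≡.subst (dot w v ≤_) (≡.sym (dot-A⁺ i)) (≤A⁺ i)
      ; atA⁻ = λ i → ≡.subst (dot w v ≤_) (≡.sym (dot-A⁻ i)) (≤A⁻ i)
      ; atB = ≡.subst (dot w v ≤_) (≡.sym dot-B) ≤B
      ; atC = ≡.subst (dot w v ≤_) (≡.sym dot-C) ≤C }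
      where open Minimal m

    -- Since eA i (+1) + eA i (−1) = 2 eB, a face containing both Aᵢ± contains B ...
    A±⇒B : ∀ i → InF (eA i (+ 1)) → InF (eA i -1ℤ) → InF eB
    A±⇒B i a⁺ a⁻ = sameWeight w f {eA i (+ 1)} {eB} (≡.trans dot-B (≡.sym (≡.trans (dot-A⁺ i) u+t≡t))) a⁺
      where
      ui≡0 : u i ≡ 0ℤ
      ui≡0 = balanced-below (≡.subst₂ _≤_ (dot-A⁺ i) ≡.refl (Minimal.≤B (minimal {eA i (+ 1)} a⁺)))
                            (≡.subst₂ _≤_ (dot-A⁻ i) ≡.refl (Minimal.≤B (minimal {eA i -1ℤ} a⁻)))
      u+t≡t : u i + t ≡ t
      u+t≡t = ≡.trans (≡.cong (_+ t) ui≡0) (ℤP.+-identityˡ t)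

    B⇒A± : InF eB → ∀ i → InF (eA i (+ 1)) × InF (eA i -1ℤ)
    B⇒A± b i = sameWeight w f {eB} {eA i (+ 1)} (≡.trans (dot-A⁺ i) (≡.trans (≡.cong (_+ t) ui≡0) t≡B)) b
             , sameWeight w f {eB} {eA i -1ℤ} (≡.trans (dot-A⁻ i) (≡.trans (≡.cong (λ z → - z + t) ui≡0) t≡B)) b
      where
      open Minimal (≡.subst Minimal dot-B (minimal {eB} b))
      ui≡0 : u i ≡ 0ℤ
      ui≡0 = balanced-above (≤A⁺ i) (≤A⁻ i)
      t≡B : 0ℤ + t ≡ dot w eB
      t≡B = ≡.trans (ℤP.+-identityˡ t) (≡.sym dot-B)

    -- Since eB + eC = 0, a face containing B and C contains the origin.
    B,C⇒origin : InF eB → InF eC → InF origin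
    B,C⇒origin b c = sameWeight w f {eB} {origin} (≡.trans (dot-origin w) (≡.sym (≡.trans dot-B t≡0))) b
      where
      t≡0 : t ≡ 0ℤ
      t≡0 = ℤP.≤-antisym (Minimal.≤origin (≡.subst Minimal dot-B (minimal {eB} b)))
                         (ℤP.neg-cancel-≤ {t} {0ℤ} (Minimal.≤origin (≡.subst Minimal dot-C (minimal {eC} c))))

    -- Faces are nonempty, so a face avoiding the origin, all Aᵢ± and B contains C.
    forcedC : ¬ InF origin → (∀ i → ¬ InF (eA i (+ 1))) → (∀ i → ¬ InF (eA i -1ℤ)) → ¬ InF eB → InF eC
    forcedC o∉ a⁺∉ a⁻∉ b∉ with faceVertex w f
    ... | v , v∈ , v-face = All.lookup (allSpanning {λ e → InF e → InF eC} record
            { atOrigin = λ o → ⊥-elim (o∉ o) ; atA⁺ = λ i a⁺ → ⊥-elim (a⁺∉ i a⁺)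
            ; atA⁻ = λ i a⁻ → ⊥-elim (a⁻∉ i a⁻) ; atB = λ b → ⊥-elim (b∉ b) ; atC = λ c → c })
            v∈ v-face

  data Shape (w : Exp (suc n)) : Set where
    loneA⁺ : ∀ i → InFace w f (eA i (+ 1)) → ¬ InFace w f (eA i -1ℤ) → Shape w
    loneA⁻ : ∀ i → ¬ InFace w f (eA i (+ 1)) → InFace w f (eA i -1ℤ) → Shape w
    allAB  : (∀ i → InFace w f (eA i (+ 1))) → (∀ i → InFace w f (eA i -1ℤ)) →
             InFace w f eB → ¬ InFace w f eC → Shape w
    onlyC  : (∀ i → ¬ InFace w f (eA i (+ 1))) → (∀ i → ¬ InFace w f (eA i -1ℤ)) →
             ¬ InFace w f eB → InFace w f eC → Shape w

  classify : ∀ w → ¬ InFace w f origin → Shape w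
  classify w o∉ = byA (FinP.any? (λ i → inFace? w f (eA i (+ 1)) ⊎-dec inFace? w f (eA i -1ℤ)))
    where
    open Weights w

    throughB : InF eB → Shape w
    throughB b = allAB (λ i → proj₁ (B⇒A± b i)) (λ i → proj₂ (B⇒A± b i)) b
                       (λ c → o∉ (B,C⇒origin b c))

    withA⁺ : ∀ i → InF (eA i (+ 1)) → Dec (InF (eA i -1ℤ)) → Shape w
    withA⁺ i a⁺ (yes a⁻) = throughB (A±⇒B i a⁺ a⁻)
    withA⁺ i a⁺ (no a⁻∉) = loneA⁺ i a⁺ a⁻∉

    withA⁻ : ∀ i → InF (eA i -1ℤ) → Dec (InF (eA i (+ 1))) → Shape w
    withA⁻ i a⁻ (yes a⁺) = throughB (A±⇒B i a⁺ a⁻)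
    withA⁻ i a⁻ (no a⁺∉) = loneA⁻ i a⁺∉ a⁻

    withoutA : (∀ i → ¬ InF (eA i (+ 1))) → (∀ i → ¬ InF (eA i -1ℤ)) → Dec (InF eB) → Shape w
    withoutA a⁺∉ a⁻∉ (yes b) = throughB b
    withoutA a⁺∉ a⁻∉ (no b∉) = onlyC a⁺∉ a⁻∉ b∉ (forcedC o∉ a⁺∉ a⁻∉ b∉)

    byA : Dec (∃ λ i → InF (eA i (+ 1)) ⊎ InF (eA i -1ℤ)) → Shape w
    byA (yes (i , inj₁ a⁺)) = withA⁺ i a⁺ (inFace? w f (eA i -1ℤ))
    byA (yes (i , inj₂ a⁻)) = withA⁻ i a⁻ (inFace? w f (eA i (+ 1)))
    byA (no noA) = withoutA (λ i a⁺ → noA (i , inj₁ a⁺)) (λ i a⁻ → noA (i , inj₂ a⁻)) (inFace? w f eB)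

  -- The face cut out by w↓ = −e_Y has weight −1 and is exactly {Aᵢ±, B}.
  w↓ : Exp (suc n)
  w↓ = unit Y -1ℤ

  module Downward where
    open Weights w↓

    u≡0 : ∀ i → u i ≡ 0ℤ
    u≡0 i = unit-other -1ℤ (ι≢Y i)

    t≡-1 : t ≡ -1ℤ
    t≡-1 = unit-same Y -1ℤ

    B∈ : InF eB
    B∈ = minimal⇒InF {eB} (≡.subst Minimal (≡.sym dot-B) (record
      { ≤origin = ≡.subst (_≤ 0ℤ) (≡.sym t≡-1) ℤ.-≤+
      ; ≤A⁺ = λ i → ℤP.≤-reflexive (≡.sym (≡.trans (≡.cong (_+ t) (u≡0 i)) (ℤP.+-identityˡ t)))
      ; ≤A⁻ = λ i → ℤP.≤-reflexive (≡.sym (≡.trans (≡.cong (λ z → - z + t) (u≡0 i)) (ℤP.+-identityˡ t)))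
      ; ≤B = ℤP.≤-refl
      ; ≤C = ≡.subst (λ z → z ≤ - z) (≡.sym t≡-1) ℤ.-≤+ }))

    origin∉ : ¬ InF origin
    origin∉ o with ≡.subst₂ _≤_ (dot-origin w↓) t≡-1 (Minimal.≤B (minimal {origin} o))
    ... | ()

    C∉ : ¬ InF eC
    C∉ c with ≡.subst₂ _≤_ (≡.trans dot-C (≡.cong -_ t≡-1)) t≡-1 (Minimal.≤B (minimal {eC} c))
    ... | ()

signChoice : ∀ {r} {m} {R : Fin m → Bool → Set r} → (∀ i → ¬ ¬ (R i true ⊎ R i false)) →
  ¬ ¬ (∃ λ (s : Vec Bool m) → ∀ i → R i (Vec.lookup s i))
signChoice {m = zero}  choices k = k ([] , λ ())
signChoice {m = suc m} {R} choices k =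
  choices zero λ r₀ → signChoice {R = λ i → R (suc i)} (λ i → choices (suc i)) λ (s , rs) → k (extend r₀ s rs)
  where
  extend : R zero true ⊎ R zero false → (s : Vec Bool m) → (∀ i → R (suc i) (Vec.lookup s i)) →
    ∃ λ (s : Vec Bool (suc m)) → ∀ i → R i (Vec.lookup s i)
  extend (inj₁ r₀) s rs = true ∷ s  , λ { zero → r₀ ; (suc i) → rs i }
  extend (inj₂ r₀) s rs = false ∷ s , λ { zero → r₀ ; (suc i) → rs i }

module SignProduct {c ℓ} (F : Field c ℓ) (n : ℕ) (a : Fin (suc n) → Field.Carrier F) where
  open Field F
  open FieldFacts F
  open Example F using (signVecs; factor; signProduct)

  signVecs-complete : ∀ {m} (s : Vec Bool m) → s ∈ signVecs m
  signVecs-complete []          = here ≡.refl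
  signVecs-complete (true ∷ s)  = ∈-concatMap⁺ _ (lose (signVecs-complete s) (here ≡.refl))
  signVecs-complete (false ∷ s) = ∈-concatMap⁺ _ (lose (signVecs-complete s) (there (here ≡.refl)))

  productOver : List (Vec Bool n) → Carrier
  productOver = foldr (λ s acc → factor n a s * acc) 1#

  factor-nonzero : ¬ signProduct n a ≈ 0# → ∀ s → ¬ factor n a s ≈ 0#
  factor-nonzero P≉0 s fs≈0 = P≉0 (vanishes (signVecs-complete s))
    where
    vanishes : ∀ {L} → s ∈ L → productOver L ≈ 0#
    vanishes (here ≡.refl) = trans (*-congʳ fs≈0) (zeroˡ _)
    vanishes (there s∈L)   = trans (*-congˡ (vanishes s∈L)) (zeroʳ _)

  product-nonzero : (∀ s → ¬ factor n a s ≈ 0#) → ¬ signProduct n a ≈ 0#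
  product-nonzero fs≉0 = nonzero (signVecs n)
    where
    nonzero : ∀ L → ¬ productOver L ≈ 0#
    nonzero []      = 1≉0
    nonzero (s ∷ L) = *-nonzero (fs≉0 s) (nonzero L)

module ExampleEvaluation {c ℓ c′ ℓ′} (F : Field c ℓ) (K : Field c′ ℓ′)
    (φ : Field.Carrier F → Field.Carrier K)
    (hom : RingMorphisms.IsRingHomomorphism (Field.rawRing F) (Field.rawRing K) φ)
    (n : ℕ) (a : Fin (suc n) → Field.Carrier F) (a≉0 : ∀ i → ¬ Field._≈_ F (a i) (Field.0# F)) where
  private
    module F  = Field F
    module LF = Laurent F
  open Field K hiding (zero)
  open FieldFacts K
  open MonomialFacts K
  open Laurent K using (intPow; finSum)
  open Derivatives F K φ hom
  open RingMorphisms.IsRingHomomorphism hom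
  open ExponentFacts
  open ExampleFaces F n a
  open SignProduct F n a
  open Newton F using (inFace?; restrict; NonDegenerate)
  open Example F using (factor; signProduct; two)
  open import Relation.Binary.Reasoning.Setoid setoid

  two± : Bool → F.Carrier
  two± b = if b then two else F.- two

  sign+sign⁻¹ : ∀ {z} b → z ≈ sign b → intPow z (+ 1) + intPow z -1ℤ ≈ φ (two± b)
  sign+sign⁻¹ {z} b z≈± = begin
    (z * 1#) + ((z ⁻¹) * 1#)  ≈⟨ +-cong (*-identityʳ _) (*-identityʳ _) ⟩
    z + (z ⁻¹)                ≈⟨ +-congˡ (self-inverse z≉0 (trans (*-cong z≈± z≈±) (sign² b))) ⟩
    z + z                     ≈⟨ +-cong z≈± z≈± ⟩
    sign b + sign b           ≈⟨ doubled b ⟩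
    φ (two± b)                ∎
    where
    z≉0 : ¬ z ≈ 0#
    z≉0 z≈0 = sign-nonzero b (trans (sym z≈±) z≈0)
    φ-two : φ two ≈ 1# + 1#
    φ-two = trans (+-homo _ _) (+-cong 1#-homo 1#-homo)
    doubled : ∀ b → sign b + sign b ≈ φ (two± b)
    doubled true  = sym φ-two
    doubled false = sym (trans (-‿homo _) (trans (-‿cong φ-two) (sym (-‿+-comm _ _))))

  module AtX (x : Fin (suc n) → Carrier) (x≉0 : ∀ j → ¬ x j ≈ 0#) where
    open AtPoint x x≉0 public

    α : Fin n → Carrier
    α i = φ (a (ι i))

    y : Carrier
    y = intPow (x Y) (+ 1)

    x⁺ x⁻ : Fin n → Carrier
    x⁺ i = intPow (x (ι i)) (+ 1)
    x⁻ i = intPow (x (ι i)) -1ℤ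

    y-nonzero : ¬ y ≈ 0#
    y-nonzero = intPow-nonzero (x≉0 Y) (+ 1)

    value-A : ∀ i k → value (a (ι i) , eA i k) ≈ α i * (y * intPow (x (ι i)) k)
    value-A i k = *-congˡ (trans (monomial-addUnit x eB (ι i) k (unit-other (+ 1) (ι≢Y i)))
                                 (*-congʳ (monomial-unit x Y (+ 1))))

    value-B : value B ≈ φ (a Y) * y
    value-B = *-congˡ (monomial-unit x Y (+ 1))

    T : Carrier
    T = finSum (λ i → α i * (x⁺ i + x⁻ i)) + φ (a Y)

    T-at-signs : ∀ s → (∀ i → x (ι i) ≈ sign (Vec.lookup s i)) → T ≈ φ (factor n a s)
    T-at-signs s x≈s = sym (begin
      φ (factor n a s)
        ≈⟨ +-homo _ _ ⟩
      φ (LF.finSum (λ i → two± (Vec.lookup s i) F.* a (ι i))) + φ (a Y)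
        ≈⟨ +-congʳ (φ-finSum (λ i → two± (Vec.lookup s i) F.* a (ι i))) ⟩
      finSum (λ i → φ (two± (Vec.lookup s i) F.* a (ι i))) + φ (a Y)
        ≈⟨ +-congʳ (finSum-cong λ i → trans (*-homo _ _)
             (trans (*-comm _ _) (*-congˡ (sym (sign+sign⁻¹ _ (x≈s i)))))) ⟩
      T ∎)

    module Restricted {q} {Q : LF.Term (suc n) → Set q} (Q? : ∀ t → Dec (Q t)) where
      S : Fin (suc n) → Carrier
      S j = sumOver (weighted j) (filter Q? f)

      expand : ∀ g → sumOver g (filter Q? f) ≈
        finSum (λ i → when (Q? (A⁺ i)) (g (A⁺ i)) + (when (Q? (A⁻ i)) (g (A⁻ i)) + 0#))
          + (when (Q? B) (g B) + (when (Q? C) (g C) + 0#))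
      expand g = trans (sumOver-filter Q? g f)
        (trans (sumOver-++ _ (concatMap pairA (allFinList n)) _) (+-congʳ (sumOver-concatMap _ pairA)))

      -- only Aᵢ± involve xᵢ, with exponents ±1
      S-ι : ∀ i → S (ι i) ≈ when (Q? (A⁺ i)) (value (A⁺ i)) - when (Q? (A⁻ i)) (value (A⁻ i))
      S-ι i = begin
        S (ι i)
          ≈⟨ expand (weighted (ι i)) ⟩
        _ ≈⟨ +-cong (finSum-single _ i others)
                    (+-cong (when-zero (Q? B) (weighted-0 (ι i) B (unit-other (+ 1) (ι≢Y i))))
                            (trans (+-identityʳ _) (when-zero (Q? C) (weighted-0 (ι i) C (unit-other -1ℤ (ι≢Y i)))))) ⟩
        (when (Q? (A⁺ i)) (weighted (ι i) (A⁺ i)) + (when (Q? (A⁻ i)) (weighted (ι i) (A⁻ i)) + 0#)) + (0# + 0#)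
          ≈⟨ trans (+-congˡ (+-identityʳ _)) (+-identityʳ _) ⟩
        when (Q? (A⁺ i)) (weighted (ι i) (A⁺ i)) + (when (Q? (A⁻ i)) (weighted (ι i) (A⁻ i)) + 0#)
          ≈⟨ +-cong (when-cong (Q? (A⁺ i)) (weighted-1 (ι i) (A⁺ i) (eA-ι i (+ 1))))
                    (trans (+-identityʳ _) (trans (when-cong (Q? (A⁻ i)) (weighted-−1 (ι i) (A⁻ i) (eA-ι i -1ℤ)))
                                                  (when-neg (Q? (A⁻ i))))) ⟩
        when (Q? (A⁺ i)) (value (A⁺ i)) - when (Q? (A⁻ i)) (value (A⁻ i)) ∎
        where
        others : ∀ i′ → i′ ≢ i →
          when (Q? (A⁺ i′)) (weighted (ι i) (A⁺ i′)) + (when (Q? (A⁻ i′)) (weighted (ι i) (A⁻ i′)) + 0#) ≈ 0#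
        others i′ i′≢i = trans
          (+-cong (when-zero (Q? (A⁺ i′)) (weighted-0 (ι i) (A⁺ i′) (eA-ι-other (+ 1) (λ eq → i′≢i (≡.sym eq)))))
                  (trans (+-identityʳ _) (when-zero (Q? (A⁻ i′)) (weighted-0 (ι i) (A⁻ i′) (eA-ι-other -1ℤ (λ eq → i′≢i (≡.sym eq)))))))
          (+-identityʳ _)

      -- every term involves x_{n+1}, with exponent −1 for C and +1 otherwise
      S-Y : S Y ≈ finSum (λ i → when (Q? (A⁺ i)) (value (A⁺ i)) + when (Q? (A⁻ i)) (value (A⁻ i)))
                  + (when (Q? B) (value B) - when (Q? C) (value C))
      S-Y = trans (expand (weighted Y))
        (+-cong (finSum-cong λ i → +-cong (when-cong (Q? (A⁺ i)) (weighted-1 Y (A⁺ i) (eA-Y i (+ 1))))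
                                          (trans (+-identityʳ _) (when-cong (Q? (A⁻ i)) (weighted-1 Y (A⁻ i) (eA-Y i -1ℤ)))))
                (+-cong (when-cong (Q? B) (weighted-1 Y B (unit-same Y (+ 1))))
                        (trans (+-identityʳ _) (trans (when-cong (Q? C) (weighted-−1 Y C (unit-same Y -1ℤ)))
                                                      (when-neg (Q? C))))))

    module OnFullFace {q} {Q : LF.Term (suc n) → Set q} (Q? : ∀ t → Dec (Q t))
        (A⁺∈ : ∀ i → Q (A⁺ i)) (A⁻∈ : ∀ i → Q (A⁻ i)) (B∈ : Q B) (C∉ : ¬ Q C) where
      open Restricted Q? public

      S-ι-full : ∀ i → S (ι i) ≈ (α i * y) * (x⁺ i - x⁻ i)
      S-ι-full i = begin
        S (ι i)
          ≈⟨ S-ι i ⟩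
        when (Q? (A⁺ i)) (value (A⁺ i)) - when (Q? (A⁻ i)) (value (A⁻ i))
          ≈⟨ +-cong (when-yes (Q? (A⁺ i)) (A⁺∈ i)) (-‿cong (when-yes (Q? (A⁻ i)) (A⁻∈ i))) ⟩
        value (A⁺ i) - value (A⁻ i)
          ≈⟨ +-cong (trans (value-A i (+ 1)) (sym (*-assoc _ _ _))) (-‿cong (trans (value-A i -1ℤ) (sym (*-assoc _ _ _)))) ⟩
        (α i * y) * x⁺ i - (α i * y) * x⁻ i
          ≈⟨ x[y-z]≈xy-xz _ _ _ ⟨
        (α i * y) * (x⁺ i - x⁻ i) ∎

      S-Y-full : S Y ≈ T * y
      S-Y-full = begin
        S Y
          ≈⟨ S-Y ⟩
        finSum (λ i → when (Q? (A⁺ i)) (value (A⁺ i)) + when (Q? (A⁻ i)) (value (A⁻ i)))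
          + (when (Q? B) (value B) - when (Q? C) (value C))
          ≈⟨ +-cong (finSum-cong λ i → +-cong (when-yes (Q? (A⁺ i)) (A⁺∈ i)) (when-yes (Q? (A⁻ i)) (A⁻∈ i)))
                    (trans (+-cong (when-yes (Q? B) B∈) (trans (-‿cong (when-no (Q? C) C∉)) -0#≈0#)) (+-identityʳ _)) ⟩
        finSum (λ i → value (A⁺ i) + value (A⁻ i)) + value B
          ≈⟨ +-cong (finSum-cong pair) value-B ⟩
        finSum (λ i → (α i * (x⁺ i + x⁻ i)) * y) + φ (a Y) * y
          ≈⟨ +-congʳ (finSum-*ʳ (λ i → α i * (x⁺ i + x⁻ i)) y) ⟩
        finSum (λ i → α i * (x⁺ i + x⁻ i)) * y + φ (a Y) * y
          ≈⟨ distribʳ _ _ _ ⟨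
        T * y ∎
        where
        pair : ∀ i → value (A⁺ i) + value (A⁻ i) ≈ (α i * (x⁺ i + x⁻ i)) * y
        pair i = begin
          value (A⁺ i) + value (A⁻ i)        ≈⟨ +-cong (value-A i (+ 1)) (value-A i -1ℤ) ⟩
          α i * (y * x⁺ i) + α i * (y * x⁻ i) ≈⟨ distribˡ _ _ _ ⟨
          α i * (y * x⁺ i + y * x⁻ i)         ≈⟨ *-congˡ (distribˡ _ _ _) ⟨
          α i * (y * (x⁺ i + x⁻ i))           ≈⟨ *-congˡ (*-comm _ _) ⟩
          α i * ((x⁺ i + x⁻ i) * y)           ≈⟨ *-assoc _ _ _ ⟨
          (α i * (x⁺ i + x⁻ i)) * y           ∎

  module CommonZero (w : Exp (suc n)) (x : Fin (suc n) → Carrier) (x≉0 : ∀ j → ¬ x j ≈ 0#)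
      (∂≈0 : ∀ j → AtPoint.∂at x x≉0 j (restrict w f) ≈ 0#) where
    open AtX x x≉0
    open Weights w using (InF)

    face? : ∀ (t : LF.Term (suc n)) → Dec (InF (proj₂ t))
    face? t = inFace? w f (proj₂ t)

    open Restricted face?

    S≈0 : ∀ j → S j ≈ 0#
    S≈0 j = ∂at-zero⇒ j (restrict w f) (∂≈0 j)

    loneA⁺-impossible : ∀ i → InF (eA i (+ 1)) → ¬ InF (eA i -1ℤ) → ⊥
    loneA⁺-impossible i a⁺ a⁻∉ = value-nonzero (A⁺ i) (a≉0 (ι i)) (begin
      value (A⁺ i)       ≈⟨ +-identityʳ _ ⟨
      value (A⁺ i) + 0#  ≈⟨ +-cong (when-yes (face? (A⁺ i)) a⁺) (-‿zero (when-no (face? (A⁻ i)) a⁻∉)) ⟨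
      _                  ≈⟨ S-ι i ⟨
      S (ι i)            ≈⟨ S≈0 (ι i) ⟩
      0#                 ∎)

    loneA⁻-impossible : ∀ i → ¬ InF (eA i (+ 1)) → InF (eA i -1ℤ) → ⊥
    loneA⁻-impossible i a⁺∉ a⁻ = -‿nonzero (value-nonzero (A⁻ i) (a≉0 (ι i))) (begin
      - value (A⁻ i)       ≈⟨ +-identityˡ _ ⟨
      0# - value (A⁻ i)    ≈⟨ +-cong (when-no (face? (A⁺ i)) a⁺∉) (-‿cong (when-yes (face? (A⁻ i)) a⁻)) ⟨
      _                    ≈⟨ S-ι i ⟨
      S (ι i)              ≈⟨ S≈0 (ι i) ⟩
      0#                   ∎)

    onlyC-impossible : (∀ i → ¬ InF (eA i (+ 1))) → (∀ i → ¬ InF (eA i -1ℤ)) → ¬ InF eB → InF eC → ⊥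
    onlyC-impossible a⁺∉ a⁻∉ b∉ c = -‿nonzero (value-nonzero C (FieldFacts.1≉0 F)) (begin
      - value C         ≈⟨ +-identityˡ _ ⟨
      0# - value C      ≈⟨ +-cong (trans (finSum-cong noA) (finSum-zeros {n}))
                                  (trans (+-cong (when-no (face? B) b∉) (-‿cong (when-yes (face? C) c))) (+-identityˡ _)) ⟨
      _                 ≈⟨ S-Y ⟨
      S Y               ≈⟨ S≈0 Y ⟩
      0#                ∎)
      where
      noA : ∀ i → when (face? (A⁺ i)) (value (A⁺ i)) + when (face? (A⁻ i)) (value (A⁻ i)) ≈ 0#
      noA i = trans (+-cong (when-no (face? (A⁺ i)) (a⁺∉ i)) (when-no (face? (A⁻ i)) (a⁻∉ i))) (+-identityʳ _)

    allAB-impossible : ¬ signProduct n a F.≈ F.0# →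
      (∀ i → InF (eA i (+ 1))) → (∀ i → InF (eA i -1ℤ)) → InF eB → ¬ InF eC → ⊥
    allAB-impossible P≉0 a⁺ a⁻ b c∉ =
      signChoice {R = λ i b → x (ι i) ≈ sign b} (λ i → square≈1⇒±1 (x²≈1 i)) λ (s , x≈s) →
        φ-nonzero (factor-nonzero P≉0 s) (trans (sym (T-at-signs s x≈s)) T≈0)
      where
      open OnFullFace face? a⁺ a⁻ b c∉ using (S-ι-full; S-Y-full)
      x²≈1 : ∀ i → x (ι i) * x (ι i) ≈ 1#
      x²≈1 i = x¹≈x⁻¹⇒x²≈1 (x≉0 (ι i)) (x∙y⁻¹≈ε⇒x≈y (x⁺ i) (x⁻ i)
        (nonzero-cancel (*-nonzero (φ-nonzero (a≉0 (ι i))) y-nonzero) (trans (sym (S-ι-full i)) (S≈0 (ι i)))))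
      T≈0 : T ≈ 0#
      T≈0 = nonzero-cancel y-nonzero (trans (*-comm _ _) (trans (sym S-Y-full) (S≈0 Y)))

    impossible : ¬ signProduct n a F.≈ F.0# → Shape w → ⊥
    impossible P≉0 (loneA⁺ i a⁺ a⁻∉)     = loneA⁺-impossible i a⁺ a⁻∉
    impossible P≉0 (loneA⁻ i a⁺∉ a⁻)     = loneA⁻-impossible i a⁺∉ a⁻
    impossible P≉0 (allAB a⁺ a⁻ b c∉)    = allAB-impossible P≉0 a⁺ a⁻ b c∉
    impossible P≉0 (onlyC a⁺∉ a⁻∉ b∉ c) = onlyC-impossible a⁺∉ a⁻∉ b∉ c

  product≉0⇒nonDegenerate : ¬ signProduct n a F.≈ F.0# → NonDegenerate K φ f
  product≉0⇒nonDegenerate P≉0 w o∉ (x , x≉0 , ∂≈0) =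
    CommonZero.impossible w x x≉0 ∂≈0 P≉0 (classify w o∉)

  signPoint : ∀ {m} → Vec Bool m → Fin (suc m) → Carrier
  signPoint []      zero    = 1#
  signPoint (b ∷ s) zero    = sign b
  signPoint (b ∷ s) (suc j) = signPoint s j

  signPoint-ι : ∀ {m} (s : Vec Bool m) i → signPoint s (inject₁ i) ≡ sign (Vec.lookup s i)
  signPoint-ι (b ∷ s) zero    = ≡.refl
  signPoint-ι (b ∷ s) (suc i) = signPoint-ι s i

  signPoint-nonzero : ∀ {m} (s : Vec Bool m) j → ¬ signPoint s j ≈ 0#
  signPoint-nonzero []      zero    = 1≉0
  signPoint-nonzero (b ∷ s) zero    = sign-nonzero b
  signPoint-nonzero (b ∷ s) (suc j) = signPoint-nonzero s j

  factor≈0⇒degenerate : ∀ s → factor n a s F.≈ F.0# → ¬ NonDegenerate K φ f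
  factor≈0⇒degenerate s fs≈0 nd = nd w↓ Downward.origin∉ (x , x≉0 , ∂≈0)
    where
    x : Fin (suc n) → Carrier
    x = signPoint s
    x≉0 : ∀ j → ¬ x j ≈ 0#
    x≉0 = signPoint-nonzero s
    open AtX x x≉0
    open OnFullFace (λ t → inFace? w↓ f (proj₂ t))
      (λ i → proj₁ (Weights.B⇒A± w↓ Downward.B∈ i)) (λ i → proj₂ (Weights.B⇒A± w↓ Downward.B∈ i))
      Downward.B∈ Downward.C∉
    x≈s : ∀ i → x (ι i) ≈ sign (Vec.lookup s i)
    x≈s i = reflexive (signPoint-ι s i)
    x⁺≈x⁻ : ∀ i → x⁺ i ≈ x⁻ i
    x⁺≈x⁻ i = x²≈1⇒x¹≈x⁻¹ (x≉0 (ι i)) (trans (*-cong (x≈s i) (x≈s i)) (sign² (Vec.lookup s i)))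
    T≈0 : T ≈ 0#
    T≈0 = trans (T-at-signs s x≈s) (trans (⟦⟧-cong fs≈0) 0#-homo)
    ∂≈0 : ∀ j → ∂at j (restrict w↓ f) ≈ 0#
    ∂≈0 j with view j
    ... | ‵fromℕ     = ⇒∂at-zero Y (restrict w↓ f) (trans S-Y-full (trans (*-congʳ T≈0) (zeroˡ _)))
    ... | ‵inject₁ i = ⇒∂at-zero (ι i) (restrict w↓ f) (trans (S-ι-full i) (trans (*-congˡ (x≈y⇒x∙y⁻¹≈ε (x⁺≈x⁻ i))) (zeroʳ _)))

-- the arithmetic vocabulary of the statement (hypotheses the proof does not need)
open import Data.Nat using (_≤_; _^_)
open import Data.Nat.Primality using (Prime)

mainTheorem3 : ∀ {c ℓ c' ℓ'} (n : ℕ) → 2 ≤ n →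
  (p q : ℕ) → Prime p → (∃ λ k → 1 ≤ k × q ≡ p ^ k) →
  (F : Field c ℓ) → HasSize F q →
  (K : Field c' ℓ') (φ : Field.Carrier F → Field.Carrier K) → IsAlgebraicClosure F K φ →
  (a : Fin (suc n) → Field.Carrier F) → (∀ i → ¬ Field._≈_ F (a i) (Field.0# F)) →
  Newton.NonDegenerate F K φ (Example.fPoly F n a)
    ⇔ (¬ Field._≈_ F (Example.signProduct F n a) (Field.0# F))
mainTheorem3 n _ p q _ _ F _ K φ closure a a≉0 =
  mk⇔ (λ nonDegenerate → product-nonzero λ s factor≈0 → factor≈0⇒degenerate s factor≈0 nonDegenerate)
      product≉0⇒nonDegenerate
  where
  open SignProduct F n a using (product-nonzero)
  open ExampleEvaluation F K φ (IsAlgebraicClosure.isRingHom closure) n a a≉0
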